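{- Let $p$ be an odd prime and $(\alpha,\beta)\in(\mathbb{Z}/(p-1)\mathbb{Z})^2$. Let $I_{(\alpha,\beta)}=\{\pm2\alpha,\pm2\beta,\pm\alpha\pm\beta\}\subseteq\mathbb{Z}/(p-1)\mathbb{Z}$ (the multiset-free set of the eight values $\delta_1\alpha+\delta_2\beta$ with $|\delta_1|+|\delta_2|=2$). Then the conditions (1) $\#I_{(\alpha,\beta)}=8$, (2) $1\notin I_{(\alpha,\beta)}$, (3) $\mathcal{C}(\bar\chi^{p-\epsilon})=0$ for all $\epsilon\in I_{(\alpha,\beta)}$ are together equivalent to the conditions (a) $(\alpha,\beta)$ is not a solution $(x,y)$ of any of the equations $2x=\pm\epsilon$, $2y=\pm\epsilon$ for $\epsilon\in\bar{\mathcal{E}}$; (b) $(\alpha,\beta)$ is not a solution of any of the equations $y=\pm x\pm\epsilon$ for $\epsilon\in\bar{\mathcal{E}}$; (c) $(\alpha,\beta)$ is not a solution of any of the equations $y=\pm3x$, $3y=\pm x$, where all equations are in $\mathbb{Z}/(p-1)\mathbb{Z}$.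
   Context: $\bar\chi$ is the mod-$p$ cyclotomic character. Let $\mathcal{C}$ be the class group of $\mathbb{Q}(\mu_p)$ tensored with $\mathbb{F}_p$, with the natural action of $\operatorname{Gal}(\mathbb{Q}(\mu_p)/\mathbb{Q})$, and for $i\in\mathbb{Z}/(p-1)\mathbb{Z}$ let $\mathcal{C}(\bar\chi^i)=\{x\in\mathcal{C}:g\cdot x=\bar\chi^i(g)x\ \forall g\}$. Let $\mathcal{E}=\{\epsilon\in\mathbb{Z}/(p-1)\mathbb{Z}:\mathcal{C}(\bar\chi^\epsilon)\neq0\}$, $\mathcal{E}^*=\{p-\epsilon\in\mathbb{Z}/(p-1)\mathbb{Z}:\epsilon\in\mathcal{E}\}\setminus\{0,\tfrac{p-1}{2}\}$, and $\bar{\mathcal{E}}=\mathcal{E}^*\cup\{0,1,\tfrac{p-1}{2}\}$. -}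

module Defs where

open import Level using (0ℓ)
open import Data.Nat as ℕ using (ℕ; _∸_)
open import Data.Nat.DivMod using (_/_)
open import Data.Integer using (ℤ; +_; _+_; _-_; -_; _*_)
open import Data.Integer.Divisibility using (_∣_)
open import Data.List using (List; []; _∷_)
open import Data.List.Relation.Unary.All using (All)
open import Data.List.Relation.Unary.Any using (Any)
open import Data.List.Relation.Unary.AllPairs using (AllPairs)
open import Data.Product using (Σ; _×_; ∃)
open import Data.Sum using (_⊎_)
open import Relation.Nullary using (¬_)

-- Elements of ℤ/(p-1)ℤ are represented by integers; equality in ℤ/(p-1)ℤ
-- is congruence modulo (p-1).
infix 4 _≡[_]_
_≡[_]_ : ℤ → ℕ → ℤ → Set
a ≡[ p ] b = (+ (p ∸ 1)) ∣ (a - b)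

half : ℕ → ℤ
half p = + ((p ∸ 1) / 2)

WellDefined : ℕ → (ℤ → Set) → Set
WellDefined p P = ∀ i j → i ≡[ p ] j → P i → P j

-- Given NV (NV i means  C(χ̄^i) ≠ 0), the set ℰ is {ε : NV ε}.
-- ℰ* = {p - ε : ε ∈ ℰ} \ {0, (p-1)/2}
InEstar : ℕ → (ℤ → Set) → ℤ → Set
InEstar p NV x =
  (∃ λ e → NV e × x ≡[ p ] (+ p - e)) × ¬ (x ≡[ p ] + 0) × ¬ (x ≡[ p ] half p)

InEbar : ℕ → (ℤ → Set) → ℤ → Set
InEbar p NV x =
  InEstar p NV x ⊎ (x ≡[ p ] + 0) ⊎ (x ≡[ p ] + 1) ⊎ (x ≡[ p ] half p)

Ivals : ℤ → ℤ → List ℤ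
Ivals α β =
  (+ 2 * α) ∷ (- (+ 2 * α)) ∷ (+ 2 * β) ∷ (- (+ 2 * β)) ∷
  (α + β) ∷ (α - β) ∷ (- α + β) ∷ (- α - β) ∷ []

-- (1) #I = 8 : the eight values are pairwise distinct in ℤ/(p-1)ℤ
Cond1 : ℕ → ℤ → ℤ → Set
Cond1 p α β = AllPairs (λ a b → ¬ (a ≡[ p ] b)) (Ivals α β)

Cond2 : ℕ → ℤ → ℤ → Set
Cond2 p α β = ¬ Any (λ x → x ≡[ p ] + 1) (Ivals α β)

Cond3 : ℕ → (ℤ → Set) → ℤ → ℤ → Set
Cond3 p NV α β = All (λ ε → ¬ NV (+ p - ε)) (Ivals α β)

CondA : ℕ → (ℤ → Set) → ℤ → ℤ → Set
CondA p NV α β = ∀ ε → InEbar p NV ε →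
  ¬ ((+ 2 * α) ≡[ p ] ε) × ¬ ((+ 2 * α) ≡[ p ] (- ε)) ×
  ¬ ((+ 2 * β) ≡[ p ] ε) × ¬ ((+ 2 * β) ≡[ p ] (- ε))

CondB : ℕ → (ℤ → Set) → ℤ → ℤ → Set
CondB p NV α β = ∀ ε → InEbar p NV ε →
  ¬ (β ≡[ p ] (α + ε)) × ¬ (β ≡[ p ] (α - ε)) ×
  ¬ (β ≡[ p ] (- α + ε)) × ¬ (β ≡[ p ] (- α - ε))

CondC : ℕ → ℤ → ℤ → Set
CondC p α β =
  ¬ (β ≡[ p ] (+ 3 * α)) × ¬ (β ≡[ p ] (- (+ 3 * α))) ×
  ¬ ((+ 3 * β) ≡[ p ] α) × ¬ ((+ 3 * β) ≡[ p ] (- α))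

{-# OPTIONS --safe #-}
-- Everything is measured against the condition I ∩ Ē = ∅, which (a) and (b)
-- state equation by equation.  Write p - 1 = 2h.  The set I is closed under
-- negation, so (1) implies v ≢ -v, i.e. 2v ≢ 0, i.e. v ≢ 0, h for all v ∈ I;
-- as 0, h ∈ Ē, this together with (2) (1 ∉ I) and (3) (ε ∈ ℰ* iff p - ε ∈ ℰ)
-- gives I ∩ Ē = ∅.  Conversely, the difference of any two elements of I is a
-- multiple of 2v for some v ∈ I, or of one of β ∓ 3α, 3β ∓ α; the first kind
-- cannot vanish since 0, h ∈ Ē, the second is excluded by (c), which also
-- follows from (1) in the same way.  An element x ∈ I with p - x ∈ ℰ would lie
-- in ℰ* ∪ {0, h} ⊆ Ē, which gives (3).
module Submission where

open import Defs
open import Data.Nat using (ℕ)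
open import Data.Nat.Divisibility using (_∣_)
open import Data.Nat.Primality using (Prime)
open import Data.Integer using (ℤ)
open import Data.Product using (_×_)
open import Function.Bundles using (_⇔_)
open import Relation.Nullary using (¬_)

open import Data.Nat as ℕ using (_∸_; suc; s≤s; _<_)
open import Data.Nat.DivMod using (_/_; _%_; m%n<n; m≡m%n+[m/n]*n; m*[n/m]≡n)
open import Data.Nat.Divisibility using (divides; _∣?_)
open import Data.Integer using (+_; _+_; _-_; -_; _*_; ∣_∣)
open import Data.Integer.Properties using (pos-*; *-cancelˡ-≡; *-identityˡ; *-zeroˡ; +-identityʳ; +-inverseʳ)
open import Data.Integer.DivMod using (_%ℕ_; _/ℕ_; a≡a%ℕn+[a/ℕn]*n; n%ℕd<d)
import Data.Integer.Divisibility.Signed as Signed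
open import Data.Integer.Tactic.RingSolver using (solve)
open import Data.List using (List; []; _∷_)
open import Data.List.Membership.Propositional using (_∈_)
open import Data.List.Relation.Unary.All using (All; lookupAny; tabulate)
open import Data.List.Relation.Unary.Any as Any using (Any; here; there)
open import Data.List.Relation.Unary.AllPairs as AllPairs using (AllPairs)
open import Data.Product using (∃; _,_)
open import Data.Sum using (_⊎_; inj₁; inj₂)
open import Function.Base using (_∘_; case_of_)
open import Function.Bundles using (mk⇔; Equivalence)
open import Relation.Nullary using (yes; no; contradiction)
import Relation.Nullary.Decidable as Dec
open import Relation.Binary.PropositionalEquality using (_≡_; refl; sym; cong; subst; module ≡-Reasoning)

odd⇒pred-even : ∀ {n} → ¬ 2 ∣ n → 2 ∣ n ∸ 1
odd⇒pred-even {n} 2∤n with n % 2 | m%n<n n 2 | m≡m%n+[m/n]*n n 2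
... | 0 | _ | n≡[n/2]*2 = contradiction (divides (n / 2) n≡[n/2]*2) 2∤n
... | 1 | _ | n≡1+[n/2]*2 = divides (n / 2) (cong (_∸ 1) n≡1+[n/2]*2)
... | suc (suc _) | s≤s (s≤s ()) | _

pred≡2*half : ∀ {p} → ¬ 2 ∣ p → + (p ∸ 1) ≡ + 2 * half p
pred≡2*half {p} 2∤p = begin
  + (p ∸ 1)               ≡⟨ cong +_ (m*[n/m]≡n (odd⇒pred-even 2∤p)) ⟨
  + (2 ℕ.* ((p ∸ 1) / 2)) ≡⟨ pos-* 2 ((p ∸ 1) / 2) ⟩
  + 2 * half p            ∎
  where open ≡-Reasoning

module Congruence (p : ℕ) where

  -- _≡[ p ]_ unfolds to divisibility of ∣ x - y ∣, from which Agda cannot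
  -- recover x and y; wrapped in a record, the endpoints become inferable.
  infix 4 _≈_ _≈?_
  record _≈_ (x y : ℤ) : Set where
    constructor ⟦_⟧
    field ⌊_⌋ : x ≡[ p ] y
  open _≈_ public

  private variable a b c d e f x y : ℤ

  ≈-from-∣ : + (p ∸ 1) Signed.∣ x - y → x ≈ y
  ≈-from-∣ m∣x-y = ⟦ Signed.∣⇒∣ᵤ m∣x-y ⟧

  ∣-from-≈ : x ≈ y → + (p ∸ 1) Signed.∣ x - y
  ∣-from-≈ x≈y = Signed.∣ᵤ⇒∣ ⌊ x≈y ⌋

  ≈-reflexive : x ≡ y → x ≈ y
  ≈-reflexive {x} refl = ≈-from-∣ (Signed.divides (+ 0) (+-inverseʳ x))

  ≈-refl : x ≈ x
  ≈-refl = ≈-reflexive refl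

  ≡[]-refl : ∀ x → x ≡[ p ] x
  ≡[]-refl x = ⌊ ≈-refl {x} ⌋

  -- The premises come first so that c and d are known when solve runs.
  ≈-linear : c ≈ d → ∀ k → a - b ≡ k * (c - d) → a ≈ b
  ≈-linear c≈d k eq =
    ≈-from-∣ (subst (+ (p ∸ 1) Signed.∣_) (sym eq) (Signed.∣n⇒∣m*n k (∣-from-≈ c≈d)))

  ≈-linear₂ : c ≈ d → e ≈ f → ∀ k l → a - b ≡ k * (c - d) + l * (e - f) → a ≈ b
  ≈-linear₂ c≈d e≈f k l eq = ≈-from-∣ (subst (+ (p ∸ 1) Signed.∣_) (sym eq)
    (Signed.∣m∣n⇒∣m+n (Signed.∣n⇒∣m*n k (∣-from-≈ c≈d)) (Signed.∣n⇒∣m*n l (∣-from-≈ e≈f))))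

  ≈-trans : a ≈ b → b ≈ c → a ≈ c
  ≈-trans {a} {b} {c} a≈b b≈c = ≈-linear₂ a≈b b≈c (+ 1) (+ 1) (solve (a ∷ b ∷ c ∷ []))

  x≈z-[z-x] : ∀ x z → x ≈ z - (z - x)
  x≈z-[z-x] x z = ≈-reflexive (solve (x ∷ z ∷ []))

  x≈y∧2y≈0⇒2x≈0 : x ≈ y → + 2 * y ≈ + 0 → + 2 * x ≈ + 0
  x≈y∧2y≈0⇒2x≈0 {x} {y} x≈y 2y≈0 = ≈-linear₂ x≈y 2y≈0 (+ 2) (+ 1) (solve (x ∷ y ∷ []))

  resp : ∀ {P} → WellDefined p P → P x → x ≈ y → P y
  resp {x} {y} wd Px x≈y = wd x y ⌊ x≈y ⌋ Px

  resp-complement : ∀ {P} → WellDefined p P → ∀ z → P e → x ≈ z - e → P (z - x)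
  resp-complement {e} {x} wd z Pe x≈z-e = resp wd Pe e≈z-x
    where
    e≈z-x : e ≈ z - x
    e≈z-x = ≈-linear x≈z-e (+ 1) (solve (x ∷ z ∷ e ∷ []))

  _≈?_ : ∀ x y → Dec.Dec (x ≈ y)
  x ≈? y = Dec.map′ ⟦_⟧ ⌊_⌋ (p ∸ 1 ∣? ∣ x - y ∣)

  module _ {h : ℤ} (p-1≡2h : + (p ∸ 1) ≡ + 2 * h) where

    2x≈0⇒x≈0⊎x≈h : ∀ x → + 2 * x ≈ + 0 → x ≈ + 0 ⊎ x ≈ h
    2x≈0⇒x≈0⊎x≈h x 2x≈0 with ∣-from-≈ 2x≈0
    ... | Signed.divides c 2x≡c*[p-1] =
      by-parity (c %ℕ 2) (n%ℕd<d c 2) (a≡a%ℕn+[a/ℕn]*n c 2)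
      where
      open ≡-Reasoning

      x≡c*h : x ≡ c * h
      x≡c*h = *-cancelˡ-≡ (+ 2) x (c * h) (begin
        + 2 * x         ≡⟨ +-identityʳ (+ 2 * x) ⟨
        + 2 * x - + 0   ≡⟨ 2x≡c*[p-1] ⟩
        c * + (p ∸ 1)   ≡⟨ cong (c *_) p-1≡2h ⟩
        c * (+ 2 * h)   ≡⟨ solve (c ∷ h ∷ []) ⟩
        + 2 * (c * h)   ∎)

      x≈ρ*h : ∀ ρ t → c ≡ ρ + t * + 2 → x ≈ ρ * h
      x≈ρ*h ρ t c≡ρ+2t = ≈-from-∣ (Signed.divides t (begin
        x - ρ * h                 ≡⟨ cong (_- ρ * h) x≡c*h ⟩
        c * h - ρ * h             ≡⟨ cong (λ z → z * h - ρ * h) c≡ρ+2t ⟩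
        (ρ + t * + 2) * h - ρ * h ≡⟨ solve (ρ ∷ t ∷ h ∷ []) ⟩
        t * (+ 2 * h)             ≡⟨ cong (t *_) p-1≡2h ⟨
        t * + (p ∸ 1)             ∎))

      by-parity : ∀ r → r < 2 → c ≡ + r + (c /ℕ 2) * + 2 → x ≈ + 0 ⊎ x ≈ h
      by-parity 0 _ c≡2t =
        inj₁ (≈-trans (x≈ρ*h (+ 0) (c /ℕ 2) c≡2t) (≈-reflexive (*-zeroˡ h)))
      by-parity 1 _ c≡1+2t =
        inj₂ (≈-trans (x≈ρ*h (+ 1) (c /ℕ 2) c≡1+2t) (≈-reflexive (*-identityˡ h)))
      by-parity (suc (suc _)) (s≤s (s≤s ())) _

    2h≈0 : + 2 * h ≈ + 0
    2h≈0 = ≈-from-∣ (Signed.divides (+ 1) (begin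
      + 2 * h - + 0   ≡⟨ +-identityʳ (+ 2 * h) ⟩
      + 2 * h         ≡⟨ p-1≡2h ⟨
      + (p ∸ 1)       ≡⟨ *-identityˡ (+ (p ∸ 1)) ⟨
      + 1 * + (p ∸ 1) ∎))
      where open ≡-Reasoning

    x≈0⊎x≈h⇒2x≈0 : x ≈ + 0 ⊎ x ≈ h → + 2 * x ≈ + 0
    x≈0⊎x≈h⇒2x≈0 {x} (inj₁ x≈0) = ≈-linear x≈0 (+ 2) (solve (x ∷ []))
    x≈0⊎x≈h⇒2x≈0 {x} (inj₂ x≈h) = ≈-linear₂ x≈h 2h≈0 (+ 2) (+ 1) (solve (x ∷ h ∷ []))

module Lemma5p4 (p : ℕ) (NV : ℤ → Set) (α β : ℤ) where

  open Congruence p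

  _∈I : ℤ → Set
  ε ∈I = Any (_≈ ε) (Ivals α β)

  IAvoidsEbar : Set
  IAvoidsEbar = ∀ ε → InEbar p NV ε → ¬ ε ∈I

  CondA≈ : Set
  CondA≈ = ∀ ε → InEbar p NV ε →
    ¬ (+ 2 * α ≈ ε) × ¬ (+ 2 * α ≈ - ε) × ¬ (+ 2 * β ≈ ε) × ¬ (+ 2 * β ≈ - ε)

  CondB≈ : Set
  CondB≈ = ∀ ε → InEbar p NV ε →
    ¬ (β ≈ α + ε) × ¬ (β ≈ α - ε) × ¬ (β ≈ - α + ε) × ¬ (β ≈ - α - ε)

  CondC≈ : Set
  CondC≈ = ¬ (β ≈ + 3 * α) × ¬ (β ≈ - (+ 3 * α)) × ¬ (+ 3 * β ≈ α) × ¬ (+ 3 * β ≈ - α)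

  NoTwoTorsion : Set
  NoTwoTorsion = All (λ v → ¬ (+ 2 * v ≈ + 0)) (Ivals α β)

  Cond1≈ : Set
  Cond1≈ = AllPairs (λ x y → ¬ x ≈ y) (Ivals α β)

  condA⇔condA≈ : CondA p NV α β ⇔ CondA≈
  condA⇔condA≈ = mk⇔
    (λ A ε e → case A ε e of λ (a₁ , a₂ , a₃ , a₄) → a₁ ∘ ⌊_⌋ , a₂ ∘ ⌊_⌋ , a₃ ∘ ⌊_⌋ , a₄ ∘ ⌊_⌋)
    (λ A ε e → case A ε e of λ (a₁ , a₂ , a₃ , a₄) → a₁ ∘ ⟦_⟧ , a₂ ∘ ⟦_⟧ , a₃ ∘ ⟦_⟧ , a₄ ∘ ⟦_⟧)

  condB⇔condB≈ : CondB p NV α β ⇔ CondB≈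
  condB⇔condB≈ = mk⇔
    (λ B ε e → case B ε e of λ (b₁ , b₂ , b₃ , b₄) → b₁ ∘ ⌊_⌋ , b₂ ∘ ⌊_⌋ , b₃ ∘ ⌊_⌋ , b₄ ∘ ⌊_⌋)
    (λ B ε e → case B ε e of λ (b₁ , b₂ , b₃ , b₄) → b₁ ∘ ⟦_⟧ , b₂ ∘ ⟦_⟧ , b₃ ∘ ⟦_⟧ , b₄ ∘ ⟦_⟧)

  condC⇔condC≈ : CondC p α β ⇔ CondC≈
  condC⇔condC≈ = mk⇔
    (λ (c₁ , c₂ , c₃ , c₄) → c₁ ∘ ⌊_⌋ , c₂ ∘ ⌊_⌋ , c₃ ∘ ⌊_⌋ , c₄ ∘ ⌊_⌋)
    (λ (c₁ , c₂ , c₃ , c₄) → c₁ ∘ ⟦_⟧ , c₂ ∘ ⟦_⟧ , c₃ ∘ ⟦_⟧ , c₄ ∘ ⟦_⟧)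

  cond1⇔cond1≈ : Cond1 p α β ⇔ Cond1≈
  cond1⇔cond1≈ = mk⇔ (AllPairs.map (_∘ ⌊_⌋)) (AllPairs.map (_∘ ⟦_⟧))

  avoids⇒condA≈ : IAvoidsEbar → CondA≈
  avoids⇒condA≈ avoids ε ε∈Ē =
      (λ q → avoids ε ε∈Ē (here q))
    , (λ q → avoids ε ε∈Ē (there (here (≈-linear q (- + 1) (solve (α ∷ ε ∷ []))))))
    , (λ q → avoids ε ε∈Ē (there (there (here q))))
    , (λ q → avoids ε ε∈Ē (there (there (there (here (≈-linear q (- + 1) (solve (β ∷ ε ∷ []))))))))

  avoids⇒condB≈ : IAvoidsEbar → CondB≈
  avoids⇒condB≈ avoids ε ε∈Ē =
      (λ q → avoids ε ε∈Ē (there (there (there (there (there (there (here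
                (≈-linear q (+ 1) (solve (α ∷ β ∷ ε ∷ [])))))))))))
    , (λ q → avoids ε ε∈Ē (there (there (there (there (there (here
                (≈-linear q (- + 1) (solve (α ∷ β ∷ ε ∷ []))))))))))
    , (λ q → avoids ε ε∈Ē (there (there (there (there (here
                (≈-linear q (+ 1) (solve (α ∷ β ∷ ε ∷ [])))))))))
    , (λ q → avoids ε ε∈Ē (there (there (there (there (there (there (there (here
                (≈-linear q (- + 1) (solve (α ∷ β ∷ ε ∷ []))))))))))))

  condA≈×condB≈⇒avoids : CondA≈ → CondB≈ → IAvoidsEbar
  condA≈×condB≈⇒avoids A B ε ε∈Ē =
    let a₁ , a₂ , a₃ , a₄ = A ε ε∈Ē
        b₁ , b₂ , b₃ , b₄ = B ε ε∈Ē
    in λ where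
      (here q) → a₁ q
      (there (here q)) → a₂ (≈-linear q (- + 1) (solve (α ∷ ε ∷ [])))
      (there (there (here q))) → a₃ q
      (there (there (there (here q)))) → a₄ (≈-linear q (- + 1) (solve (β ∷ ε ∷ [])))
      (there (there (there (there (here q))))) → b₃ (≈-linear q (+ 1) (solve (α ∷ β ∷ ε ∷ [])))
      (there (there (there (there (there (here q)))))) → b₂ (≈-linear q (- + 1) (solve (α ∷ β ∷ ε ∷ [])))
      (there (there (there (there (there (there (here q))))))) → b₁ (≈-linear q (+ 1) (solve (α ∷ β ∷ ε ∷ [])))
      (there (there (there (there (there (there (there (here q)))))))) → b₄ (≈-linear q (- + 1) (solve (α ∷ β ∷ ε ∷ [])))

  InEbar-view : ∀ {ε} → InEbar p NV ε →
    (∃ λ e → NV e × ε ≈ + p - e) ⊎ (ε ≈ + 0 ⊎ ε ≈ half p) ⊎ ε ≈ + 1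
  InEbar-view (inj₁ ((e , NVe , ε≡p-e) , _)) = inj₁ (e , NVe , ⟦ ε≡p-e ⟧)
  InEbar-view (inj₂ (inj₁ ε≡0))              = inj₂ (inj₁ (inj₁ ⟦ ε≡0 ⟧))
  InEbar-view (inj₂ (inj₂ (inj₁ ε≡1)))       = inj₂ (inj₂ ⟦ ε≡1 ⟧)
  InEbar-view (inj₂ (inj₂ (inj₂ ε≡h)))       = inj₂ (inj₁ (inj₂ ⟦ ε≡h ⟧))

  ∈⇒∈I : ∀ {v c} → v ∈ Ivals α β → v ≈ c → c ∈I
  ∈⇒∈I v∈I v≈c = Any.map (λ { refl → v≈c }) v∈I

  avoids⇒no-2-torsion : + (p ∸ 1) ≡ + 2 * half p → IAvoidsEbar → NoTwoTorsion
  avoids⇒no-2-torsion p-1≡2h avoids = tabulate λ {v} v∈I 2v≈0 →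
    case 2x≈0⇒x≈0⊎x≈h p-1≡2h v 2v≈0 of λ where
      (inj₁ v≈0) → avoids (+ 0) (inj₂ (inj₁ (≡[]-refl (+ 0)))) (∈⇒∈I v∈I v≈0)
      (inj₂ v≈h) → avoids (half p) (inj₂ (inj₂ (inj₂ (≡[]-refl (half p))))) (∈⇒∈I v∈I v≈h)

  avoids⇒cond2 : IAvoidsEbar → Cond2 p α β
  avoids⇒cond2 avoids 1∈I = avoids (+ 1) (inj₂ (inj₂ (inj₁ (≡[]-refl (+ 1))))) (Any.map ⟦_⟧ 1∈I)

  NV[p-x]⇒x∈Ē : ∀ x → NV (+ p - x) → InEbar p NV x
  NV[p-x]⇒x∈Ē x NV[p-x] with x ≈? + 0 | x ≈? half p
  ... | yes x≈0 | _        = inj₂ (inj₁ ⌊ x≈0 ⌋)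
  ... | no _    | yes x≈h  = inj₂ (inj₂ (inj₂ ⌊ x≈h ⌋))
  ... | no x≉0  | no x≉h   =
    inj₁ ((+ p - x , NV[p-x] , ⌊ x≈z-[z-x] x (+ p) ⌋) , x≉0 ∘ ⟦_⟧ , x≉h ∘ ⟦_⟧)

  avoids⇒cond3 : IAvoidsEbar → Cond3 p NV α β
  avoids⇒cond3 avoids = tabulate λ {x} x∈I NV[p-x] →
    avoids x (NV[p-x]⇒x∈Ē x NV[p-x]) (∈⇒∈I x∈I ≈-refl)

  no-2-torsion×cond2×cond3⇒avoids : + (p ∸ 1) ≡ + 2 * half p → WellDefined p NV →
    NoTwoTorsion → Cond2 p α β → Cond3 p NV α β → IAvoidsEbar
  no-2-torsion×cond2×cond3⇒avoids p-1≡2h wd no-torsion c2 c3 ε ε∈Ē ε∈I with InEbar-view ε∈Ē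
  ... | inj₁ (e , NVe , ε≈p-e) =
    let ¬NV[p-x] , x≈ε = lookupAny c3 ε∈I
    in ¬NV[p-x] (resp-complement wd (+ p) NVe (≈-trans x≈ε ε≈p-e))
  ... | inj₂ (inj₁ ε≈0⊎ε≈h) =
    let 2x≉0 , x≈ε = lookupAny no-torsion ε∈I
    in 2x≉0 (x≈y∧2y≈0⇒2x≈0 x≈ε (x≈0⊎x≈h⇒2x≈0 p-1≡2h ε≈0⊎ε≈h))
  ... | inj₂ (inj₂ ε≈1) = c2 (Any.map (λ x≈ε → ⌊ ≈-trans x≈ε ε≈1 ⌋) ε∈I)

  -- Below, _∷_ is overloaded by All and AllPairs, and solve cannot resolve
  -- constructors in its (untyped) variable list, so the list is named here.
  αβ : List ℤ
  αβ = α ∷ β ∷ []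

  module _ where
    open import Data.List.Relation.Unary.All using ([]; _∷_)
    open import Data.List.Relation.Unary.AllPairs using ([]; _∷_)

    cond1≈⇒no-2-torsion : Cond1≈ → NoTwoTorsion
    cond1≈⇒no-2-torsion
      ((2α≉-2α ∷ _) ∷ _ ∷ (2β≉-2β ∷ _) ∷ _ ∷ (_ ∷ _ ∷ α+β≉-α-β ∷ []) ∷ (α-β≉-α+β ∷ _) ∷ _) =
          (λ 2v≈0 → 2α≉-2α (≈-linear 2v≈0 (+ 1) (solve αβ)))
        ∷ (λ 2v≈0 → 2α≉-2α (≈-linear 2v≈0 (- + 1) (solve αβ)))
        ∷ (λ 2v≈0 → 2β≉-2β (≈-linear 2v≈0 (+ 1) (solve αβ)))
        ∷ (λ 2v≈0 → 2β≉-2β (≈-linear 2v≈0 (- + 1) (solve αβ)))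
        ∷ (λ 2v≈0 → α+β≉-α-β (≈-linear 2v≈0 (+ 1) (solve αβ)))
        ∷ (λ 2v≈0 → α-β≉-α+β (≈-linear 2v≈0 (+ 1) (solve αβ)))
        ∷ (λ 2v≈0 → α-β≉-α+β (≈-linear 2v≈0 (- + 1) (solve αβ)))
        ∷ (λ 2v≈0 → α+β≉-α-β (≈-linear 2v≈0 (- + 1) (solve αβ)))
        ∷ []

    cond1≈⇒condC≈ : Cond1≈ → CondC≈
    cond1≈⇒condC≈
      ((_ ∷ _ ∷ _ ∷ _ ∷ _ ∷ 2α≉-α+β ∷ 2α≉-α-β ∷ []) ∷ _ ∷ (_ ∷ _ ∷ 2β≉α-β ∷ _ ∷ 2β≉-α-β ∷ []) ∷ _) =
        (λ q → 2α≉-α+β (≈-linear q (- + 1) (solve αβ)))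
      , (λ q → 2α≉-α-β (≈-linear q (+ 1) (solve αβ)))
      , (λ q → 2β≉α-β (≈-linear q (+ 1) (solve αβ)))
      , (λ q → 2β≉-α-β (≈-linear q (+ 1) (solve αβ)))

    no-2-torsion×condC≈⇒cond1≈ : NoTwoTorsion → CondC≈ → Cond1≈
    no-2-torsion×condC≈⇒cond1≈
      (2[2α]≉0 ∷ _ ∷ 2[2β]≉0 ∷ _ ∷ 2[α+β]≉0 ∷ 2[α-β]≉0 ∷ 2[-α+β]≉0 ∷ 2[-α-β]≉0 ∷ [])
      (β≉3α , β≉-3α , 3β≉α , 3β≉-α) =
        ( (λ q → 2[2α]≉0 (≈-linear q (+ 1) (solve αβ)))
        ∷ (λ q → 2[α-β]≉0 (≈-linear q (+ 1) (solve αβ)))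
        ∷ (λ q → 2[α+β]≉0 (≈-linear q (+ 1) (solve αβ)))
        ∷ (λ q → 2[α-β]≉0 (≈-linear q (+ 2) (solve αβ)))
        ∷ (λ q → 2[α+β]≉0 (≈-linear q (+ 2) (solve αβ)))
        ∷ (λ q → β≉3α (≈-linear q (- + 1) (solve αβ)))
        ∷ (λ q → β≉-3α (≈-linear q (+ 1) (solve αβ)))
        ∷ [])
      ∷ ( (λ q → 2[α+β]≉0 (≈-linear q (- + 1) (solve αβ)))
        ∷ (λ q → 2[-α+β]≉0 (≈-linear q (+ 1) (solve αβ)))
        ∷ (λ q → β≉-3α (≈-linear q (- + 1) (solve αβ)))
        ∷ (λ q → β≉3α (≈-linear q (+ 1) (solve αβ)))
        ∷ (λ q → 2[-α-β]≉0 (≈-linear q (+ 2) (solve αβ)))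
        ∷ (λ q → 2[-α+β]≉0 (≈-linear q (+ 2) (solve αβ)))
        ∷ [])
      ∷ ( (λ q → 2[2β]≉0 (≈-linear q (+ 1) (solve αβ)))
        ∷ (λ q → 2[-α+β]≉0 (≈-linear q (+ 2) (solve αβ)))
        ∷ (λ q → 3β≉α (≈-linear q (+ 1) (solve αβ)))
        ∷ (λ q → 2[α+β]≉0 (≈-linear q (+ 2) (solve αβ)))
        ∷ (λ q → 3β≉-α (≈-linear q (+ 1) (solve αβ)))
        ∷ [])
      ∷ ( (λ q → 3β≉-α (≈-linear q (- + 1) (solve αβ)))
        ∷ (λ q → 2[-α-β]≉0 (≈-linear q (+ 2) (solve αβ)))
        ∷ (λ q → 3β≉α (≈-linear q (- + 1) (solve αβ)))
        ∷ (λ q → 2[α-β]≉0 (≈-linear q (+ 2) (solve αβ)))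
        ∷ [])
      ∷ ( (λ q → 2[2β]≉0 (≈-linear q (+ 2) (solve αβ)))
        ∷ (λ q → 2[2α]≉0 (≈-linear q (+ 2) (solve αβ)))
        ∷ (λ q → 2[α+β]≉0 (≈-linear q (+ 1) (solve αβ)))
        ∷ [])
      ∷ ( (λ q → 2[α-β]≉0 (≈-linear q (+ 1) (solve αβ)))
        ∷ (λ q → 2[2α]≉0 (≈-linear q (+ 2) (solve αβ)))
        ∷ [])
      ∷ ((λ q → 2[2β]≉0 (≈-linear q (+ 2) (solve αβ))) ∷ [])
      ∷ []
      ∷ []

lemma5p4 : (p : ℕ) → Prime p → ¬ (2 ∣ p) →
    (NV : ℤ → Set) → WellDefined p NV →
    (α β : ℤ) →
    (Cond1 p α β × Cond2 p α β × Cond3 p NV α β)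
      ⇔ (CondA p NV α β × CondB p NV α β × CondC p α β)
lemma5p4 p _ 2∤p NV wd α β = mk⇔
  (λ (c1 , c2 , c3) →
    let distinct = to cond1⇔cond1≈ c1
        avoids   = no-2-torsion×cond2×cond3⇒avoids p-1≡2h wd (cond1≈⇒no-2-torsion distinct) c2 c3
    in  from condA⇔condA≈ (avoids⇒condA≈ avoids)
      , from condB⇔condB≈ (avoids⇒condB≈ avoids)
      , from condC⇔condC≈ (cond1≈⇒condC≈ distinct))
  (λ (A , B , C) →
    let avoids = condA≈×condB≈⇒avoids (to condA⇔condA≈ A) (to condB⇔condB≈ B)
    in  from cond1⇔cond1≈ (no-2-torsion×condC≈⇒cond1≈ (avoids⇒no-2-torsion p-1≡2h avoids) (to condC⇔condC≈ C))
      , avoids⇒cond2 avoids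
      , avoids⇒cond3 avoids)
  where
  open Lemma5p4 p NV α β
  open Equivalence
  p-1≡2h : + (p ∸ 1) ≡ + 2 * half p
  p-1≡2h = pred≡2*half 2∤p
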